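{- Let $D$ be a digraph with $n$ vertices that contains a directed cycle, let $g$ be its girth, and let $t$ be the number of induced directed cycles of $D$. If $tg\geq n$, then $$\alpha(D)\geq\frac{g-1}{g}\left(\frac{n^g}{tg}\right)^{\frac{1}{g-1}}.$$
   Context: All digraphs are finite, loopless and strict (at most one edge from $u$ to $v$ for distinct $u,v$). The girth of a digraph is the length of its shortest directed cycle. A vertex set is acyclic if its induced subdigraph has no directed cycle; $\alpha(D)$ is the maximum size of an acyclic vertex set of $D$. -}

module Defs where

open import Data.Nat using (ℕ; zero; suc; _≤_)
open import Data.Fin using (Fin; zero; suc; toℕ; lower₁)
open import Data.Fin.Subset using (Subset; _∈_; ∣_∣)
open import Data.Bool using (Bool; true; false; T)
open import Data.Product using (Σ; _×_; _,_; ∃)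
open import Data.List using (List; length)
open import Data.List.Relation.Unary.Unique.Propositional using (Unique)
import Data.List.Membership.Propositional as LM
open import Relation.Nullary using (¬_; yes; no)
open import Relation.Binary.PropositionalEquality using (_≡_)
open import Function.Definitions using (Injective)
import Data.Nat as N

-- A finite, loopless, strict digraph on vertex set Fin n.
-- Strictness is automatic: adjacency is a Bool-valued relation.
record Digraph (n : ℕ) : Set where
  field
    adj      : Fin n → Fin n → Bool
    loopless : ∀ v → adj v v ≡ false

open Digraph public

next : ∀ {m} → Fin (suc m) → Fin (suc m)
next {m} i with m N.≟ toℕ i
... | yes _ = zero
... | no ne = suc (lower₁ i ne)

IsCycle : ∀ {n m} → Digraph n → (Fin (suc m) → Fin n) → Set
IsCycle D c = Injective _≡_ _≡_ c × (∀ i → T (adj D (c i) (c (next i))))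

HasCycleOfLength : ∀ {n} → Digraph n → ℕ → Set
HasCycleOfLength {n} D k =
  Σ ℕ λ m → k ≡ suc m × Σ (Fin (suc m) → Fin n) λ c → IsCycle D c

HasCycle : ∀ {n} → Digraph n → Set
HasCycle D = ∃ λ k → HasCycleOfLength D k

IsGirth : ∀ {n} → Digraph n → ℕ → Set
IsGirth D g = HasCycleOfLength D g × (∀ k → HasCycleOfLength D k → g ≤ k)

Acyclic : ∀ {n} → Digraph n → Subset n → Set
Acyclic {n} D S = ∀ m (c : Fin (suc m) → Fin n) → IsCycle D c → ¬ (∀ i → c i ∈ S)

IsAlpha : ∀ {n} → Digraph n → ℕ → Set
IsAlpha {n} D a =
  (Σ (Subset n) λ S → Acyclic D S × ∣ S ∣ ≡ a) ×
  (∀ S → Acyclic D S → ∣ S ∣ ≤ a)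

-- D[S] is a directed cycle: S is the vertex set of a directed cycle c of D
-- and the only edges of D inside S are the cycle edges.
IsInducedCycleSet : ∀ {n} → Digraph n → Subset n → Set
IsInducedCycleSet {n} D S =
  Σ ℕ λ m → Σ (Fin (suc m) → Fin n) λ c →
    IsCycle D c ×
    (∀ v → (v ∈ S → ∃ λ i → c i ≡ v) × ((∃ λ i → c i ≡ v) → v ∈ S)) ×
    (∀ i j → T (adj D (c i) (c j)) → j ≡ next i)

-- t is the number of induced directed cycles of D
-- (an induced subdigraph is determined by its vertex set).
NumInducedCycles : ∀ {n} → Digraph n → ℕ → Set
NumInducedCycles {n} D t =
  Σ (List (Subset n)) λ L → Unique L ×
    (∀ S → (S LM.∈ L → IsInducedCycleSet D S) × (IsInducedCycleSet D S → S LM.∈ L)) ×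
    length L ≡ t

module Submission where

-- The proof is the probabilistic deletion argument with
-- probabilities replaced by integer weights:
-- (1) Every directed cycle inside a vertex set X contains an induced directed
--     cycle inside X (shortcut along chords).  Hence deleting one vertex from
--     each induced cycle inside S leaves an acyclic set, so
--     |S| ≤ α + #(induced cycles inside S) for every vertex set S.
-- (2) Averaging (1) over all S with weight r^|S| q^(n-|S|), s = r + q, and
--     using that induced cycles have at least g vertices, gives
--     n r s^(g-1) ≤ α s^g + t r^g.
-- (3) Choosing r = α g and s = (g-1) n turns this into the theorem.

open import Defs
open import Data.Nat
  using (ℕ; zero; suc; _+_; _*_; _^_; _∸_; _≤_; _<_; _≤?_; _<?_; z≤n; s≤s; _%_; _/_; NonZero; >-nonZero)
open import Data.Nat.Properties
open import Data.Nat.DivMod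
  using (m≡m%n+[m/n]*n; [m+kn]%n≡m%n; [m+n]%n≡m%n; n%n≡0; m%n<n; m<n⇒m%n≡m; %-distribˡ-+; m≤n⇒[n∸m]%m≡n%m)
open import Data.Nat.Induction using (<-rec)
open import Data.Nat.Tactic.RingSolver using (solve-∀)
open import Data.Fin using (Fin; zero; suc; toℕ)
import Data.Fin.Properties as Fin
open import Data.Fin.Subset using (Subset; inside; outside; _∈_; _∉_; _⊆_; _-_; ∣_∣; ⁅_⁆; Nonempty)
open import Data.Fin.Subset.Properties
  using (_⊆?_; ⊆-trans; p─q⊆p; p─⊥≡p; x∈p∧x≢y⇒x∈p-y; x∈p⇒∣p-x∣<∣p∣; x∈⁅y⁆⇒x≡y; ∣⁅x⁆∣≡1)
open import Data.Vec using ([]; _∷_; here; there; tabulate)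
open import Data.Vec.Properties using ([]=⇒lookup; lookup⇒[]=; lookup∘tabulate)
open import Data.Bool using (Bool; true; T; if_then_else_)
open import Data.Bool.Properties using (T?)
open import Data.List using (List; []; _∷_; length; map)
open import Data.Nat.ListAction using (sum)
open import Data.List.Relation.Unary.Any using (here; there)
import Data.List.Membership.Propositional as List
open import Data.Product using (Σ; _×_; _,_; ∃; proj₁; proj₂)
open import Data.Sum using (_⊎_; inj₁; inj₂)
open import Function using (_∘_)
open import Function.Definitions using (Injective)
open import Relation.Nullary using (¬_; Dec; yes; no; does; contradiction)
open import Relation.Nullary.Decidable using (_×-dec_; ¬?; dec-true)
open import Relation.Binary.PropositionalEquality
  using (_≡_; _≢_; refl; sym; trans; cong; cong₂; subst; subst₂; module ≡-Reasoning)

private variable n : ℕ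

∣p∣≤1+∣p-x∣ : ∀ (p : Subset n) x → ∣ p ∣ ≤ suc ∣ p - x ∣
∣p∣≤1+∣p-x∣ (inside  ∷ p) zero    = s≤s (≤-reflexive (cong ∣_∣ (sym (p─⊥≡p p))))
∣p∣≤1+∣p-x∣ (outside ∷ p) zero    = m≤n⇒m≤1+n (≤-reflexive (cong ∣_∣ (sym (p─⊥≡p p))))
∣p∣≤1+∣p-x∣ (inside  ∷ p) (suc x) = s≤s (∣p∣≤1+∣p-x∣ p x)
∣p∣≤1+∣p-x∣ (outside ∷ p) (suc x) = ∣p∣≤1+∣p-x∣ p x

x∉p-x : ∀ (p : Subset n) x → x ∉ p - x
x∉p-x (b ∷ p) zero    ()
x∉p-x (b ∷ p) (suc x) (there x∈p-x) = x∉p-x p x x∈p-x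

injection-size : ∀ k (f : Fin k → Fin n) → Injective _≡_ _≡_ f →
                 (p : Subset n) → (∀ i → f i ∈ p) → k ≤ ∣ p ∣
injection-size zero    f inj p f∈p = z≤n
injection-size (suc k) f inj p f∈p =
  ≤-trans (s≤s (injection-size k (f ∘ suc) (Fin.suc-injective ∘ inj) (p - f zero) rest∈))
          (x∈p⇒∣p-x∣<∣p∣ (f∈p zero))
  where
    rest∈ : ∀ i → f (suc i) ∈ p - f zero
    rest∈ i = x∈p∧x≢y⇒x∈p-y (f∈p (suc i)) (λ e → Fin.0≢1+n (sym (inj e)))

vertexSet : ∀ {k} → (Fin k → Fin n) → Subset n
vertexSet c = tabulate (λ v → does (Fin.any? (λ i → c i Fin.≟ v)))

∈vertexSet⁻ : ∀ {k} (c : Fin k → Fin n) {v} → v ∈ vertexSet c → ∃ λ i → c i ≡ v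
∈vertexSet⁻ c {v} v∈ = witness (Fin.any? (λ i → c i Fin.≟ v))
  (trans (sym (lookup∘tabulate _ v)) ([]=⇒lookup v∈))
  where
    witness : ∀ {A : Set} (d : Dec A) → does d ≡ true → A
    witness (yes a) _  = a
    witness (no _)  ()

∈vertexSet⁺ : ∀ {k} (c : Fin k → Fin n) {v} → (∃ λ i → c i ≡ v) → v ∈ vertexSet c
∈vertexSet⁺ c {v} hit = lookup⇒[]= v (vertexSet c)
  (trans (lookup∘tabulate _ v) (dec-true (Fin.any? (λ i → c i Fin.≟ v)) hit))

toℕ-next : ∀ {m} (i : Fin (suc m)) → toℕ (next i) ≡ suc (toℕ i) % suc m
toℕ-next {m} i with m ≟ toℕ i
... | yes m≡i = sym (trans (cong (λ k → suc k % suc m) (sym m≡i)) (n%n≡0 (suc m)))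
... | no  m≢i = trans (cong suc (Fin.toℕ-lower₁ i m≢i))
                      (sym (m<n⇒m%n≡m (s≤s (≤∧≢⇒< (≤-pred (Fin.toℕ<n i)) (m≢i ∘ sym)))))

suc-% : ∀ k L .{{_ : NonZero L}} → suc k % L ≡ suc (k % L) % L
suc-% k L = trans (cong (λ x → suc x % L) (m≡m%n+[m/n]*n k L))
                  ([m+kn]%n≡m%n (suc (k % L)) (k / L) L)

position : ∀ {m} → ℕ → Fin (suc m)
position zero    = zero
position (suc k) = next (position k)

toℕ-position : ∀ {m} k → toℕ (position {m} k) ≡ k % suc m
toℕ-position zero        = refl
toℕ-position {m} (suc k) = begin
  toℕ (next (position k))              ≡⟨ toℕ-next (position k) ⟩
  suc (toℕ (position {m} k)) % suc m   ≡⟨ cong (λ x → suc x % suc m) (toℕ-position k) ⟩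
  suc (k % suc m) % suc m              ≡⟨ suc-% k (suc m) ⟨
  suc k % suc m                        ∎
  where open ≡-Reasoning

position-toℕ : ∀ {m} (i : Fin (suc m)) → position (toℕ i) ≡ i
position-toℕ i = Fin.toℕ-injective (trans (toℕ-position (toℕ i)) (m<n⇒m%n≡m (Fin.toℕ<n i)))

position-periodic : ∀ {m} k → position {m} (k + suc m) ≡ position k
position-periodic {m} k = Fin.toℕ-injective
  (trans (toℕ-position (k + suc m)) (trans ([m+n]%n≡m%n k (suc m)) (sym (toℕ-position k))))

shift-fixes⇒zero : ∀ {u d L} .{{_ : NonZero L}} → u < L → d < L → (u + d) % L ≡ u → d ≡ 0
shift-fixes⇒zero {u} {d} {L} u<L d<L fixed with u + d <? L
... | yes u+d<L = +-cancelˡ-≡ u d 0 (trans (trans (sym (m<n⇒m%n≡m u+d<L)) fixed) (sym (+-identityʳ u)))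
... | no  u+d≮L = contradiction wrapped (<⇒≢ wrapped<u)
  where
    L≤u+d : L ≤ u + d
    L≤u+d = ≮⇒≥ u+d≮L
    wrapped<u : u + d ∸ L < u
    wrapped<u = subst (u + d ∸ L <_) (m+n∸n≡m u L) (∸-monoˡ-< (+-monoʳ-< u d<L) L≤u+d)
    wrapped : u + d ∸ L ≡ u
    wrapped = trans (sym (m<n⇒m%n≡m (<-trans wrapped<u u<L))) (trans (m≤n⇒[n∸m]%m≡n%m L≤u+d) fixed)

shift-injective-≤ : ∀ J {x y L} .{{_ : NonZero L}} → x ≤ y → y < L →
                    (J + x) % L ≡ (J + y) % L → x ≡ y
shift-injective-≤ J {x} {y} {L} x≤y y<L same =
  trans (sym (+-identityʳ x)) (trans (cong (x +_) (sym d≡0)) (m+[n∸m]≡n x≤y))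
  where
    d<L : y ∸ x < L
    d<L = ≤-<-trans (m∸n≤m y x) y<L
    fixed : ((J + x) % L + (y ∸ x)) % L ≡ (J + x) % L
    fixed = begin
      ((J + x) % L + (y ∸ x)) % L       ≡⟨ cong (λ z → ((J + x) % L + z) % L) (m<n⇒m%n≡m d<L) ⟨
      ((J + x) % L + (y ∸ x) % L) % L   ≡⟨ %-distribˡ-+ (J + x) (y ∸ x) L ⟨
      (J + x + (y ∸ x)) % L             ≡⟨ cong (_% L) (trans (+-assoc J x _) (cong (J +_) (m+[n∸m]≡n x≤y))) ⟩
      (J + y) % L                       ≡⟨ same ⟨
      (J + x) % L                       ∎
      where open ≡-Reasoning
    d≡0 : y ∸ x ≡ 0
    d≡0 = shift-fixes⇒zero (m%n<n (J + x) L) d<L fixed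

shift-injective : ∀ J {x y L} .{{_ : NonZero L}} → x < L → y < L →
                  (J + x) % L ≡ (J + y) % L → x ≡ y
shift-injective J {x} {y} x<L y<L same with ≤-total x y
... | inj₁ x≤y = shift-injective-≤ J x≤y y<L same
... | inj₂ y≤x = sym (shift-injective-≤ J y≤x x<L (sym same))

position-window-injective : ∀ {m} J {x y} → x < suc m → y < suc m →
                            position {m} (J + x) ≡ position (J + y) → x ≡ y
position-window-injective J x<L y<L same = shift-injective J x<L y<L
  (trans (sym (toℕ-position (J + _))) (trans (cong toℕ same) (toℕ-position (J + _))))

distance : ∀ {m} (j i : Fin (suc m)) → Σ ℕ λ d → d < suc m × position (toℕ j + d) ≡ i
distance {m} j i with toℕ j ≤? toℕ i
... | yes J≤I = toℕ i ∸ toℕ j , ≤-<-trans (m∸n≤m (toℕ i) (toℕ j)) (Fin.toℕ<n i) ,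
                trans (cong position (m+[n∸m]≡n J≤I)) (position-toℕ i)
... | no  J≰I = toℕ i + suc m ∸ toℕ j , d<L ,
                trans (cong position (m+[n∸m]≡n J≤I+L))
                      (trans (position-periodic (toℕ i)) (position-toℕ i))
  where
    J≤I+L : toℕ j ≤ toℕ i + suc m
    J≤I+L = ≤-trans (<⇒≤ (Fin.toℕ<n j)) (m≤n+m (suc m) (toℕ i))
    d<L : toℕ i + suc m ∸ toℕ j < suc m
    d<L = subst (toℕ i + suc m ∸ toℕ j <_) (m+n∸m≡n (toℕ i) (suc m))
                (∸-monoʳ-< (≰⇒> J≰I) J≤I+L)

module _ (D : Digraph n) where

  closedWalk⇒cycle : ∀ m (h : ℕ → Fin n) →
    (∀ {x y} → x < suc m → y < suc m → h x ≡ h y → x ≡ y) →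
    (∀ x → x < m → T (adj D (h x) (h (suc x)))) →
    T (adj D (h m) (h 0)) →
    IsCycle D (λ (i : Fin (suc m)) → h (toℕ i))
  closedWalk⇒cycle m h distinct step close =
    (λ {i} {j} same → Fin.toℕ-injective (distinct (Fin.toℕ<n i) (Fin.toℕ<n j) same)) , edge
    where
      edge : ∀ i → T (adj D (h (toℕ i)) (h (toℕ (next i))))
      edge i with toℕ i ≟ m
      ... | yes i≡m = subst₂ (λ x y → T (adj D (h x) (h y))) (sym i≡m) next≡0 close
        where
          next≡0 : 0 ≡ toℕ (next i)
          next≡0 = sym (trans (toℕ-next i) (trans (cong (λ k → suc k % suc m) i≡m) (n%n≡0 (suc m))))
      ... | no  i≢m = subst (λ y → T (adj D (h (toℕ i)) (h y))) next≡1+i (step (toℕ i) i<m)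
        where
          i<m : toℕ i < m
          i<m = ≤∧≢⇒< (≤-pred (Fin.toℕ<n i)) i≢m
          next≡1+i : suc (toℕ i) ≡ toℕ (next i)
          next≡1+i = sym (trans (toℕ-next i) (m<n⇒m%n≡m (s≤s i<m)))

  -- A chord c i → c j of a directed cycle c (j not the successor of i)
  -- closes the strictly shorter cycle c j → c (j+1) → … → c i → c j.
  shortcut : ∀ {m} (c : Fin (suc m) → Fin n) → IsCycle D c →
    ∀ i j → T (adj D (c i) (c j)) → j ≢ next i →
    Σ ℕ λ m′ → m′ < m × Σ (Fin (suc m′) → Fin n) λ c′ → IsCycle D c′ × (∀ x → ∃ λ y → c′ x ≡ c y)
  shortcut {m} c (injective , edge) i j chord j≢next with distance j i
  ... | d , d<L , reach =
    d , d<m , (λ x → walk (J + toℕ x)) ,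
    closedWalk⇒cycle d (λ x → walk (J + x)) distinct step close ,
    (λ x → position (J + toℕ x) , refl)
    where
      J : ℕ
      J = toℕ j
      walk : ℕ → Fin n
      walk k = c (position k)
      distinct : ∀ {x y} → x < suc d → y < suc d → walk (J + x) ≡ walk (J + y) → x ≡ y
      distinct x≤d y≤d same =
        position-window-injective J (≤-trans x≤d d<L) (≤-trans y≤d d<L) (injective same)
      step : ∀ x → x < d → T (adj D (walk (J + x)) (walk (J + suc x)))
      step x _ = subst (λ k → T (adj D (walk (J + x)) (walk k))) (sym (+-suc J x)) (edge (position (J + x)))
      close : T (adj D (walk (J + d)) (walk (J + 0)))
      close = subst₂ (λ x y → T (adj D (c x) (c y)))
                (sym reach) (sym (trans (cong position (+-identityʳ J)) (position-toℕ j))) chord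
      full⇒successor : d ≡ m → j ≡ next i
      full⇒successor d≡m = begin
        j                         ≡⟨ position-toℕ j ⟨
        position J                ≡⟨ position-periodic J ⟨
        position (J + suc m)      ≡⟨ cong (λ k → position (J + suc k)) d≡m ⟨
        position (J + suc d)      ≡⟨ cong position (+-suc J d) ⟩
        next (position (J + d))   ≡⟨ cong next reach ⟩
        next i                    ∎
        where open ≡-Reasoning
      d<m : d < m
      d<m = ≤∧≢⇒< (≤-pred d<L) (j≢next ∘ full⇒successor)

  chordOrInduced : ∀ {m} (c : Fin (suc m) → Fin n) → IsCycle D c →
    (∃ λ i → ∃ λ j → T (adj D (c i) (c j)) × j ≢ next i) ⊎ IsInducedCycleSet D (vertexSet c)
  chordOrInduced {m} c cyc
    with Fin.any? (λ i → Fin.any? (λ j → T? (adj D (c i) (c j)) ×-dec ¬? (j Fin.≟ next i)))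
  ... | yes chord   = inj₁ chord
  ... | no  ¬chord = inj₂ (m , c , cyc , (λ v → ∈vertexSet⁻ c , ∈vertexSet⁺ c) , onlyCycleEdges)
    where
      onlyCycleEdges : ∀ i j → T (adj D (c i) (c j)) → j ≡ next i
      onlyCycleEdges i j e with j Fin.≟ next i
      ... | yes j≡next = j≡next
      ... | no  j≢next = contradiction (i , j , e , j≢next) ¬chord

  -- Every directed cycle inside X contains (the vertex set of) an induced
  -- directed cycle inside X: shortcut along chords while there are any.
  InducedCycleInside : Subset n → ℕ → Set
  InducedCycleInside X m = ∀ (c : Fin (suc m) → Fin n) → IsCycle D c → (∀ i → c i ∈ X) →
    Σ (Subset n) λ C → IsInducedCycleSet D C × C ⊆ X

  inducedCycleInside : ∀ X m → InducedCycleInside X m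
  inducedCycleInside X = <-rec (InducedCycleInside X) shorten
    where
      shorten : ∀ m → (∀ {m′} → m′ < m → InducedCycleInside X m′) → InducedCycleInside X m
      shorten m shorter c cyc c∈X with chordOrInduced c cyc
      ... | inj₂ induced = vertexSet c , induced , λ v∈ →
              let (i , ci≡v) = ∈vertexSet⁻ c v∈ in subst (_∈ X) ci≡v (c∈X i)
      ... | inj₁ (i , j , chord , j≢next) with shortcut c cyc i j chord j≢next
      ...   | m′ , m′<m , c′ , cyc′ , onC =
              shorter m′<m c′ cyc′ (λ x → let (y , same) = onC x in subst (_∈ X) (sym same) (c∈X y))

[_] : Bool → ℕ
[ b ] = if b then 1 else 0

containedCount : List (Subset n) → Subset n → ℕ
containedCount []      S = 0
containedCount (C ∷ L) S = [ does (C ⊆? S) ] + containedCount L S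

hitAll : ∀ (S : Subset n) (L : List (Subset n)) → (∀ {C} → C List.∈ L → Nonempty C) →
  Σ (Subset n) λ R → R ⊆ S × ∣ S ∣ ≤ ∣ R ∣ + containedCount L S ×
                     (∀ {C} → C List.∈ L → C ⊆ S → ¬ C ⊆ R)
hitAll S []      nonempty = S , (λ x∈S → x∈S) , m≤m+n ∣ S ∣ 0 , λ ()
hitAll S (C ∷ L) nonempty with hitAll S L (nonempty ∘ there)
... | R , R⊆S , size , misses with C ⊆? S
...   | no  C⊈S = R , R⊆S , size , misses′
  where
    misses′ : ∀ {C′} → C′ List.∈ C ∷ L → C′ ⊆ S → ¬ C′ ⊆ R
    misses′ (here refl)  C⊆S  _ = C⊈S C⊆S
    misses′ (there C′∈L) C′⊆S   = misses C′∈L C′⊆S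
...   | yes C⊆S with nonempty (here refl)
...     | v , v∈C = R - v , ⊆-trans (p─q⊆p R ⁅ v ⁆) R⊆S , size′ , misses′
  where
    size′ : ∣ S ∣ ≤ ∣ R - v ∣ + suc (containedCount L S)
    size′ = ≤-trans size (≤-trans (+-monoˡ-≤ _ (∣p∣≤1+∣p-x∣ R v)) (≤-reflexive (sym (+-suc _ _))))
    misses′ : ∀ {C′} → C′ List.∈ C ∷ L → C′ ⊆ S → ¬ C′ ⊆ R - v
    misses′ (here refl)  _    C⊆R-v  = x∉p-x R v (C⊆R-v v∈C)
    misses′ (there C′∈L) C′⊆S C′⊆R-v = misses C′∈L C′⊆S (p─q⊆p R ⁅ v ⁆ ∘ C′⊆R-v)

module _ (D : Digraph n) where

  inducedCycle-nonempty : ∀ {C} → IsInducedCycleSet D C → Nonempty C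
  inducedCycle-nonempty (m , c , _ , members , _) = c zero , proj₂ (members (c zero)) (zero , refl)

  girth≤size : ∀ {g C} → IsGirth D g → IsInducedCycleSet D C → g ≤ ∣ C ∣
  girth≤size (_ , shortest) (m , c , cyc , members , _) =
    ≤-trans (shortest (suc m) (m , refl , c , cyc))
            (injection-size (suc m) c (proj₁ cyc) _ (λ i → proj₂ (members (c i)) (i , refl)))

  -- Every vertex set S has at most α(D) + (number of induced cycles inside S)
  -- vertices: after hitting all those cycles, S becomes acyclic.
  size≤alpha+cycles : ∀ {a} (L : List (Subset n)) →
    (∀ C → (C List.∈ L → IsInducedCycleSet D C) × (IsInducedCycleSet D C → C List.∈ L)) →
    IsAlpha D a → ∀ S → ∣ S ∣ ≤ a + containedCount L S
  size≤alpha+cycles L spec (_ , maximal) S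
    with hitAll S L (λ C∈L → inducedCycle-nonempty (proj₁ (spec _) C∈L))
  ... | R , R⊆S , size , misses = ≤-trans size (+-monoˡ-≤ _ (maximal R acyclic))
    where
      acyclic : Acyclic D R
      acyclic m c cyc c∈R with inducedCycleInside D R m c cyc c∈R
      ... | C , induced , C⊆R = misses (proj₂ (spec C) induced) (⊆-trans C⊆R R⊆S) C⊆R

  -- A single vertex is acyclic (D is loopless), so α(D) ≥ 1 when D has a vertex.
  alpha-positive : ∀ {a} → Fin n → IsAlpha D a → 1 ≤ a
  alpha-positive v (_ , maximal) = subst (_≤ _) (∣⁅x⁆∣≡1 v) (maximal ⁅ v ⁆ singleton-acyclic)
    where
      singleton-acyclic : Acyclic D ⁅ v ⁆
      singleton-acyclic zero    c (_ , edge) _ = subst T (loopless D (c zero)) (edge zero)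
      singleton-acyclic (suc m) c (injective , _) c∈ with
        injective (trans (x∈⁅y⁆⇒x≡y v (c∈ zero)) (sym (x∈⁅y⁆⇒x≡y v (c∈ (suc zero)))))
      ... | ()

∑ : ∀ n → (Subset n → ℕ) → ℕ
∑ zero    f = f []
∑ (suc n) f = ∑ n (λ S → f (inside ∷ S)) + ∑ n (λ S → f (outside ∷ S))

∑-cong : ∀ n {f h : Subset n → ℕ} → (∀ S → f S ≡ h S) → ∑ n f ≡ ∑ n h
∑-cong zero    f≡h = f≡h []
∑-cong (suc n) f≡h = cong₂ _+_ (∑-cong n (f≡h ∘ (inside ∷_))) (∑-cong n (f≡h ∘ (outside ∷_)))

∑-mono : ∀ n {f h : Subset n → ℕ} → (∀ S → f S ≤ h S) → ∑ n f ≤ ∑ n h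
∑-mono zero    f≤h = f≤h []
∑-mono (suc n) f≤h = +-mono-≤ (∑-mono n (f≤h ∘ (inside ∷_))) (∑-mono n (f≤h ∘ (outside ∷_)))

∑-+ : ∀ n (f h : Subset n → ℕ) → ∑ n (λ S → f S + h S) ≡ ∑ n f + ∑ n h
∑-+ zero    f h = refl
∑-+ (suc n) f h = trans
  (cong₂ _+_ (∑-+ n (f ∘ (inside ∷_)) (h ∘ (inside ∷_))) (∑-+ n (f ∘ (outside ∷_)) (h ∘ (outside ∷_))))
  (+-interchange (∑ n (f ∘ (inside ∷_))) (∑ n (h ∘ (inside ∷_)))
                 (∑ n (f ∘ (outside ∷_))) (∑ n (h ∘ (outside ∷_))))
  where
    +-interchange : ∀ a b c d → (a + b) + (c + d) ≡ (a + c) + (b + d)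
    +-interchange = solve-∀

∑-* : ∀ n k (f : Subset n → ℕ) → ∑ n (λ S → k * f S) ≡ k * ∑ n f
∑-* zero    k f = refl
∑-* (suc n) k f = trans (cong₂ _+_ (∑-* n k (f ∘ (inside ∷_))) (∑-* n k (f ∘ (outside ∷_))))
                        (sym (*-distribˡ-+ k _ _))

∑-zero : ∀ n → ∑ n (λ _ → 0) ≡ 0
∑-zero zero    = refl
∑-zero (suc n) = cong₂ _+_ (∑-zero n) (∑-zero n)

-- The weights: a vertex is in S with weight r and outside with weight q,
-- so S has weight r^|S| q^(n-|S|) and all weights add up to s^n, s = r + q.
module Weighted (r q : ℕ) where

  s : ℕ
  s = r + q

  weight : Subset n → ℕ
  weight []            = 1
  weight (inside  ∷ S) = r * weight S
  weight (outside ∷ S) = q * weight S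

  ∑-weight : ∀ n → ∑ n weight ≡ s ^ n
  ∑-weight zero    = refl
  ∑-weight (suc n) = begin
    ∑ n (λ S → r * weight S) + ∑ n (λ S → q * weight S) ≡⟨ cong₂ _+_ (∑-* n r weight) (∑-* n q weight) ⟩
    r * ∑ n weight + q * ∑ n weight                     ≡⟨ *-distribʳ-+ (∑ n weight) r q ⟨
    s * ∑ n weight                                      ≡⟨ cong (s *_) (∑-weight n) ⟩
    s * s ^ n                                           ∎
    where open ≡-Reasoning

  ∑-scaled : ∀ n k (f : Subset n → ℕ) → ∑ n (λ S → k * weight S * f S) ≡ k * ∑ n (λ S → weight S * f S)
  ∑-scaled n k f = trans (∑-cong n (λ S → *-assoc k (weight S) (f S))) (∑-* n k _)

  ∑-weight-size : ∀ n → ∑ n (λ S → weight S * ∣ S ∣) * s ≡ n * r * s ^ n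
  ∑-weight-size zero    = refl
  ∑-weight-size (suc n) = begin
    (∑ n (λ S → r * weight S * suc ∣ S ∣) + ∑ n (λ S → q * weight S * ∣ S ∣)) * s
      ≡⟨ cong (λ z → z * s) (cong₂ _+_ inside-part outside-part) ⟩
    (r * (s ^ n + M) + q * M) * s
      ≡⟨ regroup r q (s ^ n) M ⟩
    r * s ^ n * s + M * s * s
      ≡⟨ cong (λ z → r * s ^ n * s + z * s) (∑-weight-size n) ⟩
    r * s ^ n * s + n * r * s ^ n * s
      ≡⟨ collect r (s ^ n) s n ⟩
    suc n * r * (s * s ^ n)
      ∎
    where
      open ≡-Reasoning
      M : ℕ
      M = ∑ n (λ S → weight S * ∣ S ∣)
      inside-part : ∑ n (λ S → r * weight S * suc ∣ S ∣) ≡ r * (s ^ n + M)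
      inside-part = begin
        ∑ n (λ S → r * weight S * suc ∣ S ∣)             ≡⟨ ∑-cong n (λ S → split r (weight S) ∣ S ∣) ⟩
        ∑ n (λ S → r * (weight S + weight S * ∣ S ∣))     ≡⟨ ∑-* n r _ ⟩
        r * ∑ n (λ S → weight S + weight S * ∣ S ∣)       ≡⟨ cong (r *_) (∑-+ n _ _) ⟩
        r * (∑ n weight + M)                              ≡⟨ cong (λ z → r * (z + M)) (∑-weight n) ⟩
        r * (s ^ n + M)                                   ∎
        where
          split : ∀ a b c → a * b * suc c ≡ a * (b + b * c)
          split = solve-∀
      outside-part : ∑ n (λ S → q * weight S * ∣ S ∣) ≡ q * M
      outside-part = ∑-scaled n q ∣_∣
      regroup : ∀ r q P M → (r * (P + M) + q * M) * (r + q) ≡ r * P * (r + q) + M * (r + q) * (r + q)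
      regroup = solve-∀
      collect : ∀ r P s n → r * P * s + n * r * P * s ≡ suc n * r * (s * P)
      collect = solve-∀

  upWeight : Subset n → ℕ
  upWeight []            = 1
  upWeight (inside  ∷ C) = r * upWeight C
  upWeight (outside ∷ C) = s * upWeight C

  ∑-weight-⊇ : ∀ n (C : Subset n) → ∑ n (λ S → weight S * [ does (C ⊆? S) ]) ≡ upWeight C
  ∑-weight-⊇ zero    []            = refl
  ∑-weight-⊇ (suc n) (inside  ∷ C) = begin
    ∑ n (λ S → r * weight S * [ does (C ⊆? S) ]) + ∑ n (λ S → q * weight S * 0)
      ≡⟨ cong₂ _+_ (trans (∑-scaled n r _) (cong (r *_) (∑-weight-⊇ n C)))
                   (trans (∑-cong n (λ S → *-zeroʳ (q * weight S))) (∑-zero n)) ⟩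
    r * upWeight C + 0
      ≡⟨ +-identityʳ _ ⟩
    r * upWeight C
      ∎
    where open ≡-Reasoning
  ∑-weight-⊇ (suc n) (outside ∷ C) = begin
    ∑ n (λ S → r * weight S * [ does (C ⊆? S) ]) + ∑ n (λ S → q * weight S * [ does (C ⊆? S) ])
      ≡⟨ cong₂ _+_ (trans (∑-scaled n r _) (cong (r *_) (∑-weight-⊇ n C)))
                   (trans (∑-scaled n q _) (cong (q *_) (∑-weight-⊇ n C))) ⟩
    r * upWeight C + q * upWeight C
      ≡⟨ *-distribʳ-+ (upWeight C) r q ⟨
    s * upWeight C
      ∎
    where open ≡-Reasoning

  -- upWeight C = r^|C| s^(n-|C|), stated without division.
  upWeight-scaled : ∀ (C : Subset n) → upWeight C * s ^ ∣ C ∣ ≡ r ^ ∣ C ∣ * s ^ n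
  upWeight-scaled []            = refl
  upWeight-scaled {suc n} (inside ∷ C) = begin
    r * upWeight C * (s * s ^ ∣ C ∣)    ≡⟨ swap-middle r (upWeight C) s (s ^ ∣ C ∣) ⟩
    r * s * (upWeight C * s ^ ∣ C ∣)    ≡⟨ cong (r * s *_) (upWeight-scaled C) ⟩
    r * s * (r ^ ∣ C ∣ * s ^ n)         ≡⟨ swap-middle r s (r ^ ∣ C ∣) (s ^ n) ⟩
    r * r ^ ∣ C ∣ * (s * s ^ n)         ∎
    where
      open ≡-Reasoning
      swap-middle : ∀ a b c d → a * b * (c * d) ≡ a * c * (b * d)
      swap-middle = solve-∀
  upWeight-scaled {suc n} (outside ∷ C) = begin
    s * upWeight C * s ^ ∣ C ∣          ≡⟨ *-assoc s (upWeight C) _ ⟩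
    s * (upWeight C * s ^ ∣ C ∣)        ≡⟨ cong (s *_) (upWeight-scaled C) ⟩
    s * (r ^ ∣ C ∣ * s ^ n)             ≡⟨ left-comm s (r ^ ∣ C ∣) (s ^ n) ⟩
    r ^ ∣ C ∣ * (s * s ^ n)             ∎
    where
      open ≡-Reasoning
      left-comm : ∀ a b c → a * (b * c) ≡ b * (a * c)
      left-comm = solve-∀

  upWeight-bound : ∀ {g} (C : Subset n) → g ≤ ∣ C ∣ → 0 < s → upWeight C * s ^ g ≤ r ^ g * s ^ n
  upWeight-bound {n} {g} C g≤∣C∣ s>0 = *-cancelʳ-≤ _ _ (s ^ d) {{m^n≢0 s d {{>-nonZero s>0}}}} (begin
    upWeight C * s ^ g * s ^ d    ≡⟨ *-assoc (upWeight C) _ _ ⟩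
    upWeight C * (s ^ g * s ^ d)  ≡⟨ cong (λ z → upWeight C * z) (trans (sym (^-distribˡ-+-* s g d)) (cong (s ^_) g+d≡∣C∣)) ⟩
    upWeight C * s ^ ∣ C ∣        ≡⟨ upWeight-scaled C ⟩
    r ^ ∣ C ∣ * s ^ n             ≡⟨ cong (λ z → z * s ^ n) (trans (cong (r ^_) (sym g+d≡∣C∣)) (^-distribˡ-+-* r g d)) ⟩
    r ^ g * r ^ d * s ^ n         ≤⟨ *-monoˡ-≤ (s ^ n) (*-monoʳ-≤ (r ^ g) (^-monoˡ-≤ d (m≤m+n r q))) ⟩
    r ^ g * s ^ d * s ^ n         ≡⟨ *-right-comm (r ^ g) (s ^ d) (s ^ n) ⟩
    r ^ g * s ^ n * s ^ d         ∎)
    where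
      open ≤-Reasoning
      *-right-comm : ∀ a b c → a * b * c ≡ a * c * b
      *-right-comm = solve-∀
      d : ℕ
      d = ∣ C ∣ ∸ g
      g+d≡∣C∣ : g + d ≡ ∣ C ∣
      g+d≡∣C∣ = m+[n∸m]≡n g≤∣C∣

  ∑-weight-count : ∀ n (L : List (Subset n)) →
    ∑ n (λ S → weight S * containedCount L S) ≡ sum (map upWeight L)
  ∑-weight-count n []      = trans (∑-cong n (λ S → *-zeroʳ (weight S))) (∑-zero n)
  ∑-weight-count n (C ∷ L) = begin
    ∑ n (λ S → weight S * ([ does (C ⊆? S) ] + containedCount L S))
      ≡⟨ ∑-cong n (λ S → *-distribˡ-+ (weight S) _ _) ⟩
    ∑ n (λ S → weight S * [ does (C ⊆? S) ] + weight S * containedCount L S)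
      ≡⟨ ∑-+ n _ _ ⟩
    ∑ n (λ S → weight S * [ does (C ⊆? S) ]) + ∑ n (λ S → weight S * containedCount L S)
      ≡⟨ cong₂ _+_ (∑-weight-⊇ n C) (∑-weight-count n L) ⟩
    upWeight C + sum (map upWeight L)
      ∎
    where open ≡-Reasoning

  upWeights-bound : ∀ {g} (L : List (Subset n)) → (∀ {C} → C List.∈ L → g ≤ ∣ C ∣) → 0 < s →
    sum (map upWeight L) * s ^ g ≤ length L * (r ^ g * s ^ n)
  upWeights-bound []      large s>0 = z≤n
  upWeights-bound {n} {g} (C ∷ L) large s>0 = begin
    (upWeight C + sum (map upWeight L)) * s ^ g
      ≡⟨ *-distribʳ-+ (s ^ g) (upWeight C) _ ⟩
    upWeight C * s ^ g + sum (map upWeight L) * s ^ g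
      ≤⟨ +-mono-≤ (upWeight-bound C (large (here refl)) s>0) (upWeights-bound L (large ∘ there) s>0) ⟩
    r ^ g * s ^ n + length L * (r ^ g * s ^ n)
      ∎
    where open ≤-Reasoning

  averaging : ∀ n a g (L : List (Subset n)) → 0 < s →
    (∀ S → ∣ S ∣ ≤ a + containedCount L S) → (∀ {C} → C List.∈ L → g ≤ ∣ C ∣) →
    n * r * s ^ g ≤ s * (a * s ^ g + length L * r ^ g)
  averaging n a g L s>0 size≤ large = *-cancelʳ-≤ _ _ (s ^ n) {{m^n≢0 s n {{>-nonZero s>0}}}} (begin
    n * r * s ^ g * s ^ n
      ≡⟨ *-right-comm (n * r) (s ^ g) (s ^ n) ⟩
    n * r * s ^ n * s ^ g
      ≡⟨ cong (_* s ^ g) (∑-weight-size n) ⟨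
    ∑ n (λ S → weight S * ∣ S ∣) * s * s ^ g
      ≤⟨ *-monoˡ-≤ (s ^ g) (*-monoˡ-≤ s expected-size≤) ⟩
    (a * s ^ n + U) * s * s ^ g
      ≡⟨ expand a (s ^ n) U s (s ^ g) ⟩
    s * (a * s ^ g * s ^ n + U * s ^ g)
      ≤⟨ *-monoʳ-≤ s (+-monoʳ-≤ (a * s ^ g * s ^ n) (upWeights-bound L large s>0)) ⟩
    s * (a * s ^ g * s ^ n + length L * (r ^ g * s ^ n))
      ≡⟨ factor s a (s ^ g) (s ^ n) (length L) (r ^ g) ⟩
    s * (a * s ^ g + length L * r ^ g) * s ^ n
      ∎)
    where
      open ≤-Reasoning
      U : ℕ
      U = sum (map upWeight L)
      expected-size≤ : ∑ n (λ S → weight S * ∣ S ∣) ≤ a * s ^ n + U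
      expected-size≤ = begin
        ∑ n (λ S → weight S * ∣ S ∣)
          ≤⟨ ∑-mono n (λ S → *-monoʳ-≤ (weight S) (size≤ S)) ⟩
        ∑ n (λ S → weight S * (a + containedCount L S))
          ≡⟨ ∑-cong n (λ S → distrib (weight S) a (containedCount L S)) ⟩
        ∑ n (λ S → a * weight S + weight S * containedCount L S)
          ≡⟨ ∑-+ n _ _ ⟩
        ∑ n (λ S → a * weight S) + ∑ n (λ S → weight S * containedCount L S)
          ≡⟨ cong₂ _+_ (trans (∑-* n a weight) (cong (a *_) (∑-weight n))) (∑-weight-count n L) ⟩
        a * s ^ n + U
          ∎
        where
          distrib : ∀ w a k → w * (a + k) ≡ a * w + w * k
          distrib = solve-∀
      *-right-comm : ∀ a b c → a * b * c ≡ a * c * b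
      *-right-comm = solve-∀
      expand : ∀ a P U s G → (a * P + U) * s * G ≡ s * (a * G * P + U * G)
      expand = solve-∀
      factor : ∀ s a G P t R → s * (a * G * P + t * (R * P)) ≡ s * (a * G + t * R) * P
      factor = solve-∀

^-distribʳ-* : ∀ x y k → (x * y) ^ k ≡ x ^ k * y ^ k
^-distribʳ-* x y zero    = refl
^-distribʳ-* x y (suc k) = trans (cong (x * y *_) (^-distribʳ-* x y k)) (swap-middle x y (x ^ k) (y ^ k))
  where
    swap-middle : ∀ a b c d → a * b * (c * d) ≡ a * c * (b * d)
    swap-middle = solve-∀

target-form : ∀ n G → n ^ suc G * G ^ G ≡ (G * n) ^ G * n
target-form n G = trans (reverse n (n ^ G) (G ^ G)) (cong (_* n) (sym (^-distribʳ-* G n G)))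
  where
    reverse : ∀ a b c → a * b * c ≡ c * b * a
    reverse = solve-∀

-- From the averaging inequality for all weights r, q, the theorem follows by
-- taking r = a g and r + q = G n (g = G + 1); if a g ≥ G n the hypothesis
-- n ≤ t g suffices on its own.
optimise : ∀ n a t G → 1 ≤ a → n ≤ t * suc G →
  (∀ r q → 0 < r + q → n * r * (r + q) ^ suc G ≤ (r + q) * (a * (r + q) ^ suc G + t * r ^ suc G)) →
  n ^ suc G * G ^ G ≤ (a * suc G) ^ G * (t * suc G)
optimise n a t G a≥1 n≤tg averaged with G * n ≤? a * suc G
... | yes small = begin
  n ^ suc G * G ^ G              ≡⟨ target-form n G ⟩
  (G * n) ^ G * n                ≤⟨ *-mono-≤ (^-monoˡ-≤ G small) n≤tg ⟩
  (a * suc G) ^ G * (t * suc G)  ∎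
  where open ≤-Reasoning
... | no  large = *-cancelˡ-≤ a {{>-nonZero a≥1}} (begin
  a * (n ^ suc G * G ^ G)               ≡⟨ cong (a *_) (target-form n G) ⟩
  a * (s ^ G * n)                       ≤⟨ +-cancelˡ-≤ (a * s ^ suc G) _ _ gained ⟩
  t * r ^ suc G                         ≡⟨ collect t a G ((a * suc G) ^ G) ⟩
  a * ((a * suc G) ^ G * (t * suc G))   ∎)
  where
    open ≤-Reasoning
    left-comm : ∀ x y z → x * (y * z) ≡ y * (x * z)
    left-comm = solve-∀
    split : ∀ a G n X → a * (G * n * X) + a * (X * n) ≡ n * (a * suc G) * X
    split = solve-∀
    collect : ∀ t a G Y → t * (a * suc G * Y) ≡ a * (Y * (t * suc G))
    collect = solve-∀
    r s : ℕ
    r = a * suc G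
    s = G * n
    r<s : r < s
    r<s = ≰⇒> large
    r+q≡s : r + (s ∸ r) ≡ s
    r+q≡s = m+[n∸m]≡n (<⇒≤ r<s)
    s>0 : 0 < s
    s>0 = ≤-<-trans z≤n r<s
    chosen : n * r * s ^ suc G ≤ s * (a * s ^ suc G + t * r ^ suc G)
    chosen = subst (λ x → n * r * x ^ suc G ≤ x * (a * x ^ suc G + t * r ^ suc G)) r+q≡s
                   (averaged r (s ∸ r) (subst (0 <_) (sym r+q≡s) s>0))
    cancelled : n * r * s ^ G ≤ a * s ^ suc G + t * r ^ suc G
    cancelled = *-cancelˡ-≤ s {{>-nonZero s>0}} (≤-trans (≤-reflexive (left-comm s (n * r) (s ^ G))) chosen)
    gained : a * s ^ suc G + a * (s ^ G * n) ≤ a * s ^ suc G + t * r ^ suc G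
    gained = ≤-trans (≤-reflexive (split a G n (s ^ G))) cancelled

mainTheorem3 : ∀ {n} (D : Digraph n) (g t a : ℕ) → HasCycle D → IsGirth D g →
    NumInducedCycles D t → IsAlpha D a → n ≤ t * g →
    n ^ g * (g ∸ 1) ^ (g ∸ 1) ≤ (a * g) ^ (g ∸ 1) * (t * g)
mainTheorem3 D zero    t a _ ((_ , () , _) , _) _ _ _
mainTheorem3 {n} D (suc G) .(length L) a _ girth (L , _ , spec , refl) alpha n≤tg =
  optimise n a (length L) G (alpha-positive D vertex alpha) n≤tg
    λ r q s>0 → Weighted.averaging r q n a (suc G) L s>0
                  (size≤alpha+cycles D L spec alpha)
                  (λ C∈L → girth≤size D girth (proj₁ (spec _) C∈L))
  where
    vertex : Fin n
    vertex = let (_ , _ , c , _) = proj₁ girth in c zero
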